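{- Let $\mathcal{N}(P,E)$ be a ported (unoriented or oriented) matroid with a fixed ported computation tree. Then the Boolean lattice of subsets of $E$ is partitioned by the intervals $[EP(F),\,(E\setminus F)\cup IA(F)]=\{X: EP(F)\subseteq X\subseteq (E\setminus F)\cup IA(F)\}$, where $F$ ranges over the $P$-subbases of $\mathcal{N}$.
   Context: A ported matroid (or oriented matroid) $\mathcal{N}(P,E)$ is a matroid (oriented matroid) on $P\sqcup E$ with a distinguished set $P$ of ports. An element is non-separating if it is neither a loop nor a coloop. A $P$-subbasis is an independent set $F\subseteq E$ such that $F\cup P$ spans $\mathcal{N}$. A ported computation tree for $\mathcal{N}$ is a rooted binary tree with root labeled $\mathcal{N}$ such that: if $\mathcal{N}$ has a non-separating element not in $P$, then for some such $e$ the root has two subtrees, a ported computation tree for $\mathcal{N}/e$ (branch labeled "$e$ contracted") and one for $\mathcal{N}\setminus e$ (branch labeled "$e$ deleted"); otherwise the root is a leaf. For a leaf and its root path: $e\in E$ labeled "contracted" on the path is internally passive; a coloop $e\in E$ of the leaf's matroid is internally active; $e\in E$ labeled "deleted" on the path is externally passive; a loop $e\in E$ of the leaf's matroid is externally active. The internally active or passive elements of a leaf form a $P$-subbasis said to belong to the leaf, and each $P$-subbasis $F$ belongs to a unique leaf. For a $P$-subbasis $F$, $IA(F)$, $IP(F)$, $EA(F)$, $EP(F)$ denote the sets of internally active, internally passive, externally active and externally passive elements of $E$ with respect to the leaf to which $F$ belongs (so $EA(F)\cup EP(F)=E\setminus F$). -}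

module Defs where

open import Data.Nat using (ℕ; _≤_; _<_; _+_; _∸_)
open import Data.Fin using (Fin)
open import Data.Fin.Subset using (Subset; _∈_; _∉_; _⊆_; _∪_; _∩_; ∁; ⁅_⁆; ∣_∣; ⊥; ⊤)
open import Data.Product using (Σ; ∃; _×_; _,_)
open import Data.Sum using (_⊎_)
open import Relation.Nullary using (¬_)
open import Relation.Binary.PropositionalEquality using (_≡_)

record Matroid (n : ℕ) : Set where
  field
    rank        : Subset n → ℕ
    rank-bound  : ∀ X → rank X ≤ ∣ X ∣
    rank-mono   : ∀ X Y → X ⊆ Y → rank X ≤ rank Y
    rank-submod : ∀ X Y → rank (X ∪ Y) + rank (X ∩ Y) ≤ rank X + rank Y

record PortedMatroid (n : ℕ) : Set where
  field
    matroid : Matroid n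
    ports   : Subset n
  open Matroid matroid public

  E : Subset n
  E = ∁ ports

  Independent : Subset n → Set
  Independent I = rank I ≡ ∣ I ∣

  Spans : Subset n → Set
  Spans S = rank S ≡ rank ⊤

  IsPSubbasis : Subset n → Set
  IsPSubbasis F = F ⊆ E × Independent F × Spans (F ∪ ports)

  -- The minor N / C \ D (C contracted, D deleted), ground set ∁ (C ∪ D),
  -- via its rank function r_{N/C\D}(X) = r(X ∪ C) - r(C).
  minorRank : (C D : Subset n) → Subset n → ℕ
  minorRank C D X = rank (X ∪ C) ∸ rank C

  IsLoop : (C D : Subset n) → Fin n → Set
  IsLoop C D e = minorRank C D ⁅ e ⁆ ≡ 0

  IsColoop : (C D : Subset n) → Fin n → Set
  IsColoop C D e =
    minorRank C D (∁ (C ∪ D ∪ ⁅ e ⁆)) < minorRank C D (∁ (C ∪ D))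

  -- Ported computation tree for the minor N/C\D (C,D ⊆ E are the elements
  -- contracted resp. deleted along the path from the root).
  data Tree : (C D : Subset n) → Set where
    leaf : ∀ {C D} → (∀ e → e ∉ ports → e ∉ C → e ∉ D → IsLoop C D e ⊎ IsColoop C D e)
         → Tree C D
    node : ∀ {C D} → (e : Fin n) → e ∉ ports → e ∉ C → e ∉ D
         → ¬ IsLoop C D e → ¬ IsColoop C D e
         → Tree (C ∪ ⁅ e ⁆) D
         → Tree C (D ∪ ⁅ e ⁆)
         → Tree C D

  data LeafPath : {C D : Subset n} → Tree C D → Subset n → Subset n → Set where
    here  : ∀ {C D h} → LeafPath (leaf {C} {D} h) C D
    left  : ∀ {C D e p q r nl nc} {tl : Tree (C ∪ ⁅ e ⁆) D} {tr : Tree C (D ∪ ⁅ e ⁆)} {C' D'} → LeafPath tl C' D'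
          → LeafPath (node e p q r nl nc tl tr) C' D'
    right : ∀ {C D e p q r nl nc} {tl : Tree (C ∪ ⁅ e ⁆) D} {tr : Tree C (D ∪ ⁅ e ⁆)} {C' D'} → LeafPath tr C' D'
          → LeafPath (node e p q r nl nc tl tr) C' D'

  IA : (C D : Subset n) → Fin n → Set
  IA C D e = e ∈ E × e ∉ C × e ∉ D × IsColoop C D e

  -- F belongs to the leaf N/C\D: F = IP ∪ IA = C ∪ {coloops in E}.
  BelongsTo : Subset n → (C D : Subset n) → Set
  BelongsTo F C D = ∀ e → (e ∈ F → e ∈ C ⊎ IA C D e) × (e ∈ C ⊎ IA C D e → e ∈ F)

  -- X lies in the interval [EP(F), (E∖F) ∪ IA(F)], where EP(F) = D and
  -- IA(F) are taken with respect to the leaf of t to which F belongs.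
  InInterval : {C₀ D₀ : Subset n} → Tree C₀ D₀ → Subset n → Subset n → Set
  InInterval t F X = Σ (Subset n) λ C → Σ (Subset n) λ D →
    LeafPath t C D × BelongsTo F C D ×
    (D ⊆ X) × (∀ e → e ∈ X → (e ∈ E × e ∉ F) ⊎ IA C D e)

{-# OPTIONS --safe #-}
module Submission where

-- Elements of X steer a path through the computation tree: delete e when e ∈ X,
-- contract it otherwise.  The leaf N / C ∖ D reached has C ∩ X = ∅ and D ⊆ X,
-- which is exactly what puts X into the interval of the P-subbasis
-- F = C ∪ IA belonging to that leaf; two distinct leaves are separated by their
-- branching element, contracted on one side and deleted on the other, so at most
-- one leaf has this property.  F is a P-subbasis because contracting non-loops
-- keeps C independent and deleting non-coloops keeps ∁ D spanning; at the leaf,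
-- submodularity makes the coloops independent over C and puts the loops into
-- the closure of C.

open import Defs
open import Data.Nat using (ℕ; suc; _≤_; _<_; _+_; _∸_; _≟_; _<?_; s≤s; z≤n)
open import Data.Nat.Properties
  using ( ≤-trans; ≤-antisym; ≤-reflexive; n≤1+n; n≤0⇒n≡0; ≰⇒>; <⇒≱; ≮⇒≥
        ; +-suc; +-comm; +-identityʳ; +-monoʳ-≤; +-monoˡ-≤; +-mono-≤; +-cancelʳ-≤
        ; ∸-monoˡ-≤; m≤n+m∸n; m+[n∸m]≡n; m≤n⇒m∸n≡0; m∸n≡0⇒m≤n; module ≤-Reasoning )
import Data.Fin as Fin
open import Data.Fin using (Fin)
open import Data.Fin.Subset
open import Data.Fin.Subset.Properties
  using ( _∈?_; nonempty?; Empty-unique; ∉⊥; ⊥⊆; ⊆⊤; ∣⊥∣≡0; ∣⁅x⁆∣≡1; x∈⁅x⁆; x∈⁅y⁆⇒x≡y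
        ; ⊆-trans; ⊆-antisym; x∈p∪q⁺; x∈p∪q⁻; p⊆p∪q; q⊆p∪q; ∪-comm; x∈p∩q⁺
        ; x∉p⇒x∈∁p; x∈∁p⇒x∉p; p⊆q⇒∁p⊇∁q
        ; x∈p∧x∉q⇒x∈p─q; x∈p∧x≢y⇒x∈p-y; p─q⊆p; p─⊥≡p; x∈p⇒p-x⊂p )
open import Data.Fin.Subset.Induction using (⊂-wellFounded)
open import Data.Vec using ([]; _∷_; here; there; tabulate)
open import Data.Vec.Properties using (lookup∘tabulate; []=⇒lookup; lookup⇒[]=)
open import Data.Product using (Σ; ∃₂; _×_; _,_; proj₁; proj₂)
open import Data.Sum using (_⊎_; inj₁; inj₂; [_,_]′)
import Data.Sum as Sum
open import Function using (_∘_; id)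
open import Induction.WellFounded using (module All)
open import Relation.Nullary using (¬_; yes; no; does; contradiction)
open import Relation.Nullary.Decidable using (dec-true; _×-dec_; ¬?)
open import Relation.Unary using (Pred; Decidable)
open import Relation.Binary.PropositionalEquality using (_≡_; refl; sym; trans; cong; subst; subst₂)

private variable
  n : ℕ

∪⊆ : {p q r : Subset n} → p ⊆ r → q ⊆ r → p ∪ q ⊆ r
∪⊆ p⊆r q⊆r = [ p⊆r , q⊆r ]′ ∘ x∈p∪q⁻ _ _

⁅x⁆⊆ : {x : Fin n} {p : Subset n} → x ∈ p → ⁅ x ⁆ ⊆ p
⁅x⁆⊆ {x = x} x∈p y∈⁅x⁆ = subst (_∈ _) (sym (x∈⁅y⁆⇒x≡y x y∈⁅x⁆)) x∈p

x∈p─q⇒x∉q : {x : Fin n} (p q : Subset n) → x ∈ p ─ q → x ∉ q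
x∈p─q⇒x∉q (s ∷ p) (outside ∷ q) here ()
x∈p─q⇒x∉q (s ∷ p) (t ∷ q) (there x∈p─q) (there x∈q) = x∈p─q⇒x∉q p q x∈p─q x∈q

∪-mono-⊆ : {p p′ q q′ : Subset n} → p ⊆ p′ → q ⊆ q′ → p ∪ q ⊆ p′ ∪ q′
∪-mono-⊆ {p′ = p′} {q′ = q′} p⊆p′ q⊆q′ = ∪⊆ (p⊆p∪q q′ ∘ p⊆p′) (q⊆p∪q p′ q′ ∘ q⊆q′)

─-monoˡ-⊆ : {p q r : Subset n} → p ⊆ q → p ─ r ⊆ q ─ r
─-monoˡ-⊆ {p = p} {r = r} p⊆q x∈p─r = x∈p∧x∉q⇒x∈p─q (p⊆q (p─q⊆p p r x∈p─r)) (x∈p─q⇒x∉q p r x∈p─r)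

x∈∁[p∪q]⁺ : {x : Fin n} {p q : Subset n} → x ∉ p → x ∉ q → x ∈ ∁ (p ∪ q)
x∈∁[p∪q]⁺ x∉p x∉q = x∉p⇒x∈∁p ([ x∉p , x∉q ]′ ∘ x∈p∪q⁻ _ _)

∁[p∪q]∪p≡∁q : {p q : Subset n} → p ⊆ ∁ q → ∁ (p ∪ q) ∪ p ≡ ∁ q
∁[p∪q]∪p≡∁q {p = p} {q} p⊆∁q = ⊆-antisym (∪⊆ (p⊆q⇒∁p⊇∁q (q⊆p∪q p q)) p⊆∁q) ∁q⊆∁[p∪q]∪p
  where
  ∁q⊆∁[p∪q]∪p : ∁ q ⊆ ∁ (p ∪ q) ∪ p
  ∁q⊆∁[p∪q]∪p {x} x∈∁q with x ∈? p
  ... | yes x∈p = q⊆p∪q _ p x∈p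
  ... | no x∉p  = p⊆p∪q p (x∈∁[p∪q]⁺ x∉p (x∈∁p⇒x∉p x∈∁q))

⊆∁[q∪⁅x⁆] : {x : Fin n} {p q : Subset n} → p ⊆ ∁ q → x ∉ p → p ⊆ ∁ (q ∪ ⁅ x ⁆)
⊆∁[q∪⁅x⁆] {x = x} p⊆∁q x∉p y∈p = x∈∁[p∪q]⁺ (x∈∁p⇒x∉p (p⊆∁q y∈p)) (λ y∈⁅x⁆ → x∉p (subst (_∈ _) (x∈⁅y⁆⇒x≡y x y∈⁅x⁆) y∈p))

∁p-x⊆∁[p∪⁅x⁆] : {x : Fin n} {p : Subset n} → ∁ p - x ⊆ ∁ (p ∪ ⁅ x ⁆)
∁p-x⊆∁[p∪⁅x⁆] {x = x} {p} y∈ =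
  x∈∁[p∪q]⁺ (x∈∁p⇒x∉p (p─q⊆p (∁ p) ⁅ x ⁆ y∈)) (x∈p─q⇒x∉q (∁ p) ⁅ x ⁆ y∈)

p⊆⁅x⁆∪p-x : {x : Fin n} (p : Subset n) → p ⊆ ⁅ x ⁆ ∪ (p - x)
p⊆⁅x⁆∪p-x {x = x} p {y} y∈p with y Fin.≟ x
... | yes refl = x∈p∪q⁺ (inj₁ (x∈⁅x⁆ x))
... | no y≢x   = x∈p∪q⁺ (inj₂ (x∈p∧x≢y⇒x∈p-y y∈p y≢x))

∣p∣≡1+∣p-x∣ : {x : Fin n} {p : Subset n} → x ∈ p → ∣ p ∣ ≡ suc ∣ p - x ∣
∣p∣≡1+∣p-x∣ {p = inside ∷ p} here = cong (suc ∘ ∣_∣) (sym (p─⊥≡p p))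
∣p∣≡1+∣p-x∣ {p = inside ∷ p} (there x∈p) = cong suc (∣p∣≡1+∣p-x∣ x∈p)
∣p∣≡1+∣p-x∣ {p = outside ∷ p} (there x∈p) = ∣p∣≡1+∣p-x∣ x∈p

∣p∪q∣≤∣p∣+∣q∣ : (p q : Subset n) → ∣ p ∪ q ∣ ≤ ∣ p ∣ + ∣ q ∣
∣p∪q∣≤∣p∣+∣q∣ [] [] = z≤n
∣p∪q∣≤∣p∣+∣q∣ (inside ∷ p) (inside ∷ q) = s≤s (≤-trans (∣p∪q∣≤∣p∣+∣q∣ p q) (+-monoʳ-≤ ∣ p ∣ (n≤1+n _)))
∣p∪q∣≤∣p∣+∣q∣ (inside ∷ p) (outside ∷ q) = s≤s (∣p∪q∣≤∣p∣+∣q∣ p q)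
∣p∪q∣≤∣p∣+∣q∣ (outside ∷ p) (inside ∷ q) = ≤-trans (s≤s (∣p∪q∣≤∣p∣+∣q∣ p q)) (≤-reflexive (sym (+-suc ∣ p ∣ ∣ q ∣)))
∣p∪q∣≤∣p∣+∣q∣ (outside ∷ p) (outside ∷ q) = ∣p∪q∣≤∣p∣+∣q∣ p q

Empty⇒∣p∣≡0 : ∀ {n} {p : Subset n} → Empty p → ∣ p ∣ ≡ 0
Empty⇒∣p∣≡0 {n} p-empty = trans (cong ∣_∣ (Empty-unique p-empty)) (∣⊥∣≡0 n)

select : {P : Fin n → Set} → Decidable P → Subset n
select P? = tabulate (does ∘ P?)

x∈select⁺ : {P : Fin n → Set} (P? : Decidable P) {x : Fin n} → P x → x ∈ select P?
x∈select⁺ P? {x} px = lookup⇒[]= x _ (trans (lookup∘tabulate _ x) (dec-true (P? x) px))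

x∈select⁻ : {P : Fin n → Set} (P? : Decidable P) {x : Fin n} → x ∈ select P? → P x
x∈select⁻ P? {x} x∈ with P? x | trans (sym (lookup∘tabulate (does ∘ P?) x)) ([]=⇒lookup x∈)
... | yes px | _ = px
... | no _  | ()

removal-induction : ∀ {ℓ} (P : Pred (Subset n) ℓ)
  → (∀ {p} → Empty p → P p)
  → (∀ {p x} → x ∈ p → P (p - x) → P p)
  → ∀ p → P p
removal-induction P empty step = All.wfRec ⊂-wellFounded _ P induct
  where
  induct : ∀ p → (∀ {q} → q ⊂ p → P q) → P p
  induct p rec with nonempty? p
  ... | yes (x , x∈p) = step x∈p (rec (x∈p⇒p-x⊂p x∈p))
  ... | no p-empty    = empty p-empty

m∸o<n∸o⇒m<n : ∀ {m n o} → m ∸ o < n ∸ o → m < n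
m∸o<n∸o⇒m<n {o = o} m∸o<n∸o = ≰⇒> (λ n≤m → <⇒≱ m∸o<n∸o (∸-monoˡ-≤ o n≤m))

m∸o≮n∸o⇒n≤m : ∀ {m n o} → o ≤ m → ¬ (m ∸ o < n ∸ o) → n ≤ m
m∸o≮n∸o⇒n≤m {m} {n} {o} o≤m m∸o≮n∸o = begin
  n            ≤⟨ m≤n+m∸n n o ⟩
  o + (n ∸ o)  ≤⟨ +-monoʳ-≤ o (≮⇒≥ m∸o≮n∸o) ⟩
  o + (m ∸ o)  ≡⟨ m+[n∸m]≡n o≤m ⟩
  m            ∎
  where open ≤-Reasoning

module RankProperties {n : ℕ} (M : Matroid n) where
  open Matroid M
  open ≤-Reasoning

  rank-⊆ : {p q : Subset n} → p ⊆ q → rank p ≤ rank q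
  rank-⊆ = rank-mono _ _

  rank-⊥ : rank ⊥ ≡ 0
  rank-⊥ = n≤0⇒n≡0 (≤-trans (rank-bound ⊥) (≤-reflexive (∣⊥∣≡0 n)))

  rank-submodular-⊆ : ∀ Y {W G} → W ⊆ G → rank (Y ∪ G) + rank W ≤ rank (Y ∪ W) + rank G
  rank-submodular-⊆ Y {W} {G} W⊆G = begin
    rank (Y ∪ G) + rank W                    ≤⟨ +-mono-≤ (rank-⊆ (∪-mono-⊆ (p⊆p∪q W) id)) (rank-⊆ W⊆[Y∪W]∩G) ⟩
    rank ((Y ∪ W) ∪ G) + rank ((Y ∪ W) ∩ G)  ≤⟨ rank-submod (Y ∪ W) G ⟩
    rank (Y ∪ W) + rank G                    ∎
    where
    W⊆[Y∪W]∩G : W ⊆ (Y ∪ W) ∩ G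
    W⊆[Y∪W]∩G x∈W = x∈p∩q⁺ (q⊆p∪q Y W x∈W , W⊆G x∈W)

  rank-∪-absorbed : ∀ Y {C W} → C ⊆ W → rank (Y ∪ C) ≤ rank C → rank (Y ∪ W) ≤ rank W
  rank-∪-absorbed Y {C} {W} C⊆W Y∪C≤C = +-cancelʳ-≤ (rank C) _ _ (begin
    rank (Y ∪ W) + rank C  ≤⟨ rank-submodular-⊆ Y C⊆W ⟩
    rank (Y ∪ C) + rank W  ≤⟨ +-monoˡ-≤ (rank W) Y∪C≤C ⟩
    rank C + rank W        ≡⟨ +-comm (rank C) (rank W) ⟩
    rank W + rank C        ∎)

  rank-∪-loops : ∀ {C} Z → (∀ {x} → x ∈ Z → rank (⁅ x ⁆ ∪ C) ≤ rank C) → rank (Z ∪ C) ≤ rank C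
  rank-∪-loops {C} = removal-induction Claim empty step
    where
    Claim : Subset n → Set
    Claim Z = (∀ {x} → x ∈ Z → rank (⁅ x ⁆ ∪ C) ≤ rank C) → rank (Z ∪ C) ≤ rank C

    empty : ∀ {Z} → Empty Z → Claim Z
    empty Z-empty _ = rank-⊆ (∪⊆ (λ x∈Z → contradiction (_ , x∈Z) Z-empty) id)

    step : ∀ {Z x} → x ∈ Z → Claim (Z - x) → Claim Z
    step {Z} {x} x∈Z ih loops = begin
      rank (Z ∪ C)                  ≤⟨ rank-⊆ Z∪C⊆⁅x⁆∪[Z-x∪C] ⟩
      rank (⁅ x ⁆ ∪ ((Z - x) ∪ C))  ≤⟨ rank-∪-absorbed ⁅ x ⁆ (q⊆p∪q (Z - x) C) (loops x∈Z) ⟩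
      rank ((Z - x) ∪ C)            ≤⟨ ih (loops ∘ p─q⊆p Z ⁅ x ⁆) ⟩
      rank C                        ∎
      where
      Z∪C⊆⁅x⁆∪[Z-x∪C] : Z ∪ C ⊆ ⁅ x ⁆ ∪ ((Z - x) ∪ C)
      Z∪C⊆⁅x⁆∪[Z-x∪C] = ∪⊆ (⊆-trans (p⊆⁅x⁆∪p-x Z) (∪-mono-⊆ id (p⊆p∪q C)))
                            (q⊆p∪q ⁅ x ⁆ _ ∘ q⊆p∪q (Z - x) C)

  coloop-restrict : ∀ {S V x} → V ⊆ S → x ∈ V → rank (S - x) < rank S → rank (V - x) < rank V
  coloop-restrict {S} {V} {x} V⊆S x∈V S-x<S = +-cancelʳ-≤ (rank (S - x)) _ _ (begin
    suc (rank (V - x)) + rank (S - x)       ≡⟨ +-suc (rank (V - x)) (rank (S - x)) ⟨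
    rank (V - x) + suc (rank (S - x))       ≤⟨ +-monoʳ-≤ (rank (V - x)) S-x<S ⟩
    rank (V - x) + rank S                   ≡⟨ +-comm (rank (V - x)) (rank S) ⟩
    rank S + rank (V - x)                   ≤⟨ +-monoˡ-≤ (rank (V - x)) (rank-⊆ (p⊆⁅x⁆∪p-x S)) ⟩
    rank (⁅ x ⁆ ∪ (S - x)) + rank (V - x)   ≤⟨ rank-submodular-⊆ ⁅ x ⁆ (─-monoˡ-⊆ V⊆S) ⟩
    rank (⁅ x ⁆ ∪ (V - x)) + rank (S - x)   ≤⟨ +-monoˡ-≤ (rank (S - x)) (rank-⊆ (∪⊆ (⁅x⁆⊆ x∈V) (p─q⊆p V ⁅ x ⁆))) ⟩
    rank V + rank (S - x)                   ∎)

  rank-∪-coloops : ∀ {S W} Z → W ⊆ S → Z ⊆ S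
    → (∀ {x} → x ∈ Z → x ∉ W × rank (S - x) < rank S)
    → rank W + ∣ Z ∣ ≤ rank (W ∪ Z)
  rank-∪-coloops {S} {W} Z W⊆S = removal-induction Claim empty step Z
    where
    Claim : Subset n → Set
    Claim Z = Z ⊆ S → (∀ {x} → x ∈ Z → x ∉ W × rank (S - x) < rank S) → rank W + ∣ Z ∣ ≤ rank (W ∪ Z)

    empty : ∀ {Z} → Empty Z → Claim Z
    empty {Z} Z-empty _ _ = begin
      rank W + ∣ Z ∣  ≡⟨ cong (rank W +_) (Empty⇒∣p∣≡0 Z-empty) ⟩
      rank W + 0      ≡⟨ +-identityʳ (rank W) ⟩
      rank W          ≤⟨ rank-⊆ (p⊆p∪q Z) ⟩
      rank (W ∪ Z)    ∎

    step : ∀ {Z x} → x ∈ Z → Claim (Z - x) → Claim Z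
    step {Z} {x} x∈Z ih Z⊆S coloop = begin
      rank W + ∣ Z ∣              ≡⟨ cong (rank W +_) (∣p∣≡1+∣p-x∣ x∈Z) ⟩
      rank W + suc ∣ Z - x ∣      ≡⟨ +-suc (rank W) ∣ Z - x ∣ ⟩
      suc (rank W + ∣ Z - x ∣)    ≤⟨ s≤s (ih (Z⊆S ∘ p─q⊆p Z ⁅ x ⁆) (coloop ∘ p─q⊆p Z ⁅ x ⁆)) ⟩
      suc (rank (W ∪ (Z - x)))    ≤⟨ s≤s (rank-⊆ W∪[Z-x]⊆[W∪Z]-x) ⟩
      suc (rank ((W ∪ Z) - x))    ≤⟨ coloop-restrict (∪⊆ W⊆S Z⊆S) (q⊆p∪q W Z x∈Z) (proj₂ (coloop x∈Z)) ⟩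
      rank (W ∪ Z)                ∎
      where
      W∪[Z-x]⊆[W∪Z]-x : W ∪ (Z - x) ⊆ (W ∪ Z) - x
      W∪[Z-x]⊆[W∪Z]-x = ∪⊆ (λ y∈W → x∈p∧x≢y⇒x∈p-y (p⊆p∪q Z y∈W) λ { refl → proj₁ (coloop x∈Z) y∈W })
                           (─-monoˡ-⊆ (q⊆p∪q W Z))

  independent-∪ : ∀ {W} Z → rank W ≡ ∣ W ∣ → rank W + ∣ Z ∣ ≤ rank (W ∪ Z) → rank (W ∪ Z) ≡ ∣ W ∪ Z ∣
  independent-∪ {W} Z W-independent grows = ≤-antisym (rank-bound (W ∪ Z)) (begin
    ∣ W ∪ Z ∣      ≤⟨ ∣p∪q∣≤∣p∣+∣q∣ W Z ⟩
    ∣ W ∣ + ∣ Z ∣  ≡⟨ cong (_+ ∣ Z ∣) W-independent ⟨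
    rank W + ∣ Z ∣ ≤⟨ grows ⟩
    rank (W ∪ Z)   ∎)

module PortedProperties {n : ℕ} (N : PortedMatroid n) where
  open PortedMatroid N
  open RankProperties matroid
  open ≤-Reasoning

  nonloop⇒rank> : ∀ {C D e} → ¬ IsLoop C D e → rank C < rank (⁅ e ⁆ ∪ C)
  nonloop⇒rank> nonloop = ≰⇒> (nonloop ∘ m≤n⇒m∸n≡0)

  loop⇒rank≤ : ∀ {C D e} → IsLoop C D e → rank (⁅ e ⁆ ∪ C) ≤ rank C
  loop⇒rank≤ = m∸n≡0⇒m≤n

  -- Since C avoids the deleted elements, the minor's ground set together with C is ∁ D.
  coloop⇒rank< : ∀ {C D e} → C ⊆ ∁ (D ∪ ⁅ e ⁆) → IsColoop C D e → rank (∁ (D ∪ ⁅ e ⁆)) < rank (∁ D)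
  coloop⇒rank< {C} {D} {e} C⊆∁[D∪⁅e⁆] coloop =
    subst₂ (λ A B → rank A < rank B) (∁[p∪q]∪p≡∁q C⊆∁[D∪⁅e⁆]) (∁[p∪q]∪p≡∁q C⊆∁D)
      (m∸o<n∸o⇒m<n {o = rank C} coloop)
    where
    C⊆∁D : C ⊆ ∁ D
    C⊆∁D = p⊆q⇒∁p⊇∁q (p⊆p∪q ⁅ e ⁆) ∘ C⊆∁[D∪⁅e⁆]

  noncoloop⇒rank≤ : ∀ {C D e} → C ⊆ ∁ (D ∪ ⁅ e ⁆) → ¬ IsColoop C D e → rank (∁ D) ≤ rank (∁ (D ∪ ⁅ e ⁆))
  noncoloop⇒rank≤ {C} {D} {e} C⊆∁[D∪⁅e⁆] noncoloop =
    subst₂ (λ A B → rank A ≤ rank B) (∁[p∪q]∪p≡∁q C⊆∁D) (∁[p∪q]∪p≡∁q C⊆∁[D∪⁅e⁆])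
      (m∸o≮n∸o⇒n≤m (rank-⊆ (q⊆p∪q _ C)) noncoloop)
    where
    C⊆∁D : C ⊆ ∁ D
    C⊆∁D = p⊆q⇒∁p⊇∁q (p⊆p∪q ⁅ e ⁆) ∘ C⊆∁[D∪⁅e⁆]

  record Admissible (C D : Subset n) : Set where
    field
      contracted⊆E           : C ⊆ E
      contracted⊆∁deleted    : C ⊆ ∁ D
      contracted-independent : Independent C
      undeleted-spans        : Spans (∁ D)

  admissible-root : Admissible ⊥ ⊥
  admissible-root = record
    { contracted⊆E           = ⊥⊆
    ; contracted⊆∁deleted    = ⊥⊆
    ; contracted-independent = trans rank-⊥ (sym (∣⊥∣≡0 n))
    ; undeleted-spans        = cong rank (⊆-antisym ⊆⊤ (λ _ → x∉p⇒x∈∁p ∉⊥))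
    }

  admissible-contract : ∀ {C D e} → e ∉ ports → e ∉ D → ¬ IsLoop C D e
    → Admissible C D → Admissible (C ∪ ⁅ e ⁆) D
  admissible-contract {C} {D} {e} e∉P e∉D nonloop adm = record
    { contracted⊆E           = ∪⊆ contracted⊆E (⁅x⁆⊆ (x∉p⇒x∈∁p e∉P))
    ; contracted⊆∁deleted    = ∪⊆ contracted⊆∁deleted (⁅x⁆⊆ (x∉p⇒x∈∁p e∉D))
    ; contracted-independent = independent-∪ ⁅ e ⁆ contracted-independent (begin
        rank C + ∣ ⁅ e ⁆ ∣  ≡⟨ cong (rank C +_) (∣⁅x⁆∣≡1 e) ⟩
        rank C + 1          ≡⟨ +-comm (rank C) 1 ⟩
        suc (rank C)        ≤⟨ nonloop⇒rank> {D = D} nonloop ⟩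
        rank (⁅ e ⁆ ∪ C)    ≡⟨ cong rank (∪-comm ⁅ e ⁆ C) ⟩
        rank (C ∪ ⁅ e ⁆)    ∎)
    ; undeleted-spans        = undeleted-spans
    }
    where open Admissible adm

  admissible-delete : ∀ {C D e} → e ∉ C → ¬ IsColoop C D e
    → Admissible C D → Admissible C (D ∪ ⁅ e ⁆)
  admissible-delete {C} {D} {e} e∉C noncoloop adm = record
    { contracted⊆E           = contracted⊆E
    ; contracted⊆∁deleted    = C⊆∁[D∪⁅e⁆]
    ; contracted-independent = contracted-independent
    ; undeleted-spans        = ≤-antisym (rank-⊆ ⊆⊤) (begin
        rank ⊤                  ≡⟨ undeleted-spans ⟨
        rank (∁ D)              ≤⟨ noncoloop⇒rank≤ C⊆∁[D∪⁅e⁆] noncoloop ⟩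
        rank (∁ (D ∪ ⁅ e ⁆))    ∎)
    }
    where
    open Admissible adm
    C⊆∁[D∪⁅e⁆] : C ⊆ ∁ (D ∪ ⁅ e ⁆)
    C⊆∁[D∪⁅e⁆] = ⊆∁[q∪⁅x⁆] contracted⊆∁deleted e∉C

  AllSeparating : Subset n → Subset n → Set
  AllSeparating C D = ∀ e → e ∉ ports → e ∉ C → e ∉ D → IsLoop C D e ⊎ IsColoop C D e

  leaf-admissible : ∀ {C D C′ D′} {t : Tree C D} → LeafPath t C′ D′ → Admissible C D → Admissible C′ D′
  leaf-admissible here adm = adm
  leaf-admissible (left {p = e∉P} {r = e∉D} {nl = nonloop} π) adm =
    leaf-admissible π (admissible-contract e∉P e∉D nonloop adm)
  leaf-admissible (right {q = e∉C} {nc = noncoloop} π) adm =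
    leaf-admissible π (admissible-delete e∉C noncoloop adm)

  leaf-allSeparating : ∀ {C D C′ D′} {t : Tree C D} → LeafPath t C′ D′ → AllSeparating C′ D′
  leaf-allSeparating (here {h = separating}) = separating
  leaf-allSeparating (left π)  = leaf-allSeparating π
  leaf-allSeparating (right π) = leaf-allSeparating π

  IA? : ∀ C D → Decidable (IA C D)
  IA? C D x = x ∈? E ×-dec ¬? (x ∈? C) ×-dec ¬? (x ∈? D) ×-dec _ <? _

  IsLoop? : ∀ C D → Decidable (IsLoop C D)
  IsLoop? C D x = minorRank C D ⁅ x ⁆ ≟ 0

  module Leaf {C D : Subset n} (adm : Admissible C D) (separating : AllSeparating C D) where
    open Admissible adm

    internallyActive : Subset n
    internallyActive = select (IA? C D)

    loops : Subset n
    loops = select (IsLoop? C D)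

    subbasis : Subset n
    subbasis = C ∪ internallyActive

    belongsTo-subbasis : BelongsTo subbasis C D
    belongsTo-subbasis e = Sum.map₂ (x∈select⁻ (IA? C D)) ∘ x∈p∪q⁻ C internallyActive
                         , x∈p∪q⁺ ∘ Sum.map₂ (x∈select⁺ (IA? C D))

    subbasis-independent : Independent subbasis
    subbasis-independent = independent-∪ internallyActive contracted-independent
      (rank-∪-coloops internallyActive contracted⊆∁deleted IA⊆∁D coloop)
      where
      IA⊆∁D : internallyActive ⊆ ∁ D
      IA⊆∁D x∈IA = let _ , _ , x∉D , _ = x∈select⁻ (IA? C D) x∈IA in x∉p⇒x∈∁p x∉D

      coloop : ∀ {x} → x ∈ internallyActive → x ∉ C × rank (∁ D - x) < rank (∁ D)
      coloop {x} x∈IA with x∈select⁻ (IA? C D) x∈IA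
      ... | _ , x∉C , _ , x-coloop = x∉C , (begin-strict
        rank (∁ D - x)        ≤⟨ rank-⊆ ∁p-x⊆∁[p∪⁅x⁆] ⟩
        rank (∁ (D ∪ ⁅ x ⁆))  <⟨ coloop⇒rank< (⊆∁[q∪⁅x⁆] contracted⊆∁deleted x∉C) x-coloop ⟩
        rank (∁ D)            ∎)

    subbasis-spanning : Spans (subbasis ∪ ports)
    subbasis-spanning = ≤-antisym (rank-⊆ ⊆⊤) (begin
      rank ⊤                            ≡⟨ undeleted-spans ⟨
      rank (∁ D)                        ≤⟨ rank-⊆ ∁D⊆loops∪subbasis∪P ⟩
      rank (loops ∪ (subbasis ∪ ports)) ≤⟨ rank-∪-absorbed loops C⊆subbasis∪P loops∪C≤C ⟩
      rank (subbasis ∪ ports)           ∎)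
      where
      C⊆subbasis∪P : C ⊆ subbasis ∪ ports
      C⊆subbasis∪P = p⊆p∪q ports ∘ p⊆p∪q internallyActive

      loops∪C≤C : rank (loops ∪ C) ≤ rank C
      loops∪C≤C = rank-∪-loops loops (λ {x} x∈loops → loop⇒rank≤ {D = D} (x∈select⁻ (IsLoop? C D) x∈loops))

      ∁D⊆loops∪subbasis∪P : ∁ D ⊆ loops ∪ (subbasis ∪ ports)
      ∁D⊆loops∪subbasis∪P {x} x∈∁D with x ∈? ports | x ∈? C
      ... | yes x∈P | _       = q⊆p∪q loops _ (q⊆p∪q subbasis ports x∈P)
      ... | no _    | yes x∈C = q⊆p∪q loops _ (C⊆subbasis∪P x∈C)
      ... | no x∉P  | no x∉C  with separating x x∉P x∉C (x∈∁p⇒x∉p x∈∁D)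
      ...   | inj₁ loop   = p⊆p∪q _ (x∈select⁺ (IsLoop? C D) loop)
      ...   | inj₂ coloop = q⊆p∪q loops _ (p⊆p∪q ports (q⊆p∪q C _
                              (x∈select⁺ (IA? C D) (x∉p⇒x∈∁p x∉P , x∉C , x∈∁p⇒x∉p x∈∁D , coloop))))

    subbasis-isPSubbasis : IsPSubbasis subbasis
    subbasis-isPSubbasis = ∪⊆ contracted⊆E (proj₁ ∘ x∈select⁻ (IA? C D)) , subbasis-independent , subbasis-spanning

  Agrees : Subset n → Subset n → Subset n → Set
  Agrees X C D = C ⊆ ∁ X × D ⊆ X

  leafPath-agreeing : ∀ {X C D} (t : Tree C D) → Agrees X C D
    → ∃₂ λ C′ D′ → LeafPath t C′ D′ × Agrees X C′ D′
  leafPath-agreeing (leaf _) agrees = _ , _ , here , agrees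
  leafPath-agreeing {X} (node e _ _ _ _ _ tl tr) (C⊆∁X , D⊆X) with e ∈? X
  ... | yes e∈X =
    let C′ , D′ , π , agrees = leafPath-agreeing tr (C⊆∁X , ∪⊆ D⊆X (⁅x⁆⊆ e∈X))
    in  C′ , D′ , right π , agrees
  ... | no e∉X  =
    let C′ , D′ , π , agrees = leafPath-agreeing tl (∪⊆ C⊆∁X (⁅x⁆⊆ (x∉p⇒x∈∁p e∉X)) , D⊆X)
    in  C′ , D′ , left π , agrees

  leafPath-⊇ : ∀ {C D C′ D′} {t : Tree C D} → LeafPath t C′ D′ → C ⊆ C′ × D ⊆ D′
  leafPath-⊇ here      = id , id
  leafPath-⊇ (left π)  = let C⊆C′ , D⊆D′ = leafPath-⊇ π in C⊆C′ ∘ p⊆p∪q _ , D⊆D′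
  leafPath-⊇ (right π) = let C⊆C′ , D⊆D′ = leafPath-⊇ π in C⊆C′ , D⊆D′ ∘ p⊆p∪q _

  agreeing-leafPath-unique : ∀ {X C D C₁ D₁ C₂ D₂} {t : Tree C D}
    → LeafPath t C₁ D₁ → LeafPath t C₂ D₂ → Agrees X C₁ D₁ → Agrees X C₂ D₂
    → C₁ ≡ C₂ × D₁ ≡ D₂
  agreeing-leafPath-unique here       here       _  _  = refl , refl
  agreeing-leafPath-unique (left π₁)  (left π₂)  a₁ a₂ = agreeing-leafPath-unique π₁ π₂ a₁ a₂
  agreeing-leafPath-unique (right π₁) (right π₂) a₁ a₂ = agreeing-leafPath-unique π₁ π₂ a₁ a₂
  agreeing-leafPath-unique (left {e = e} π₁) (right π₂) (C₁⊆∁X , _) (_ , D₂⊆X) =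
    contradiction (D₂⊆X (proj₂ (leafPath-⊇ π₂) (q⊆p∪q _ _ (x∈⁅x⁆ e))))
                  (x∈∁p⇒x∉p (C₁⊆∁X (proj₁ (leafPath-⊇ π₁) (q⊆p∪q _ _ (x∈⁅x⁆ e)))))
  agreeing-leafPath-unique (right {e = e} π₁) (left π₂) (_ , D₁⊆X) (C₂⊆∁X , _) =
    contradiction (D₁⊆X (proj₂ (leafPath-⊇ π₁) (q⊆p∪q _ _ (x∈⁅x⁆ e))))
                  (x∈∁p⇒x∉p (C₂⊆∁X (proj₁ (leafPath-⊇ π₂) (q⊆p∪q _ _ (x∈⁅x⁆ e)))))

  belongsTo-unique : ∀ {F F′ C D} → BelongsTo F C D → BelongsTo F′ C D → F ≡ F′
  belongsTo-unique F∈ F′∈ = ⊆-antisym (λ {x} x∈F → proj₂ (F′∈ x) (proj₁ (F∈ x) x∈F))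
                                      (λ {x} x∈F′ → proj₂ (F∈ x) (proj₁ (F′∈ x) x∈F′))

  BelowTop : Subset n → Subset n → Subset n → Subset n → Set
  BelowTop F C D X = ∀ e → e ∈ X → (e ∈ E × e ∉ F) ⊎ IA C D e

  contracted⊆∁X⇒belowTop : ∀ {F C D X} → X ⊆ E → BelongsTo F C D → C ⊆ ∁ X → BelowTop F C D X
  contracted⊆∁X⇒belowTop {C = C} {D} X⊆E F∈ C⊆∁X e e∈X with IA? C D e
  ... | yes e∈IA = inj₂ e∈IA
  ... | no e∉IA  = inj₁ (X⊆E e∈X , [ (λ e∈C → x∈∁p⇒x∉p (C⊆∁X e∈C) e∈X) , e∉IA ]′ ∘ proj₁ (F∈ e))

  belowTop⇒contracted⊆∁X : ∀ {F C D X} → BelongsTo F C D → BelowTop F C D X → C ⊆ ∁ X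
  belowTop⇒contracted⊆∁X F∈ top {x} x∈C = x∉p⇒x∈∁p λ x∈X →
    [ (λ (_ , x∉F) → x∉F (proj₂ (F∈ x) (inj₁ x∈C))) , (λ (_ , x∉C , _) → x∉C x∈C) ]′ (top x x∈X)

proposition39 : (n : ℕ) (N : PortedMatroid n)
    → (t : PortedMatroid.Tree N ⊥ ⊥)
    → (X : Subset n) → X ⊆ PortedMatroid.E N
    → Σ (Subset n) (λ F → PortedMatroid.IsPSubbasis N F × PortedMatroid.InInterval N t F X)
      × ((F F′ : Subset n)
         → PortedMatroid.IsPSubbasis N F → PortedMatroid.InInterval N t F X
         → PortedMatroid.IsPSubbasis N F′ → PortedMatroid.InInterval N t F′ X
         → F ≡ F′)
proposition39 n N t X X⊆E = existence , uniqueness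
  where
  open PortedMatroid N
  open PortedProperties N

  existence : Σ (Subset n) λ F → IsPSubbasis F × InInterval t F X
  existence =
    let C , D , π , C⊆∁X , D⊆X = leafPath-agreeing t (⊥⊆ , ⊥⊆)
        open Leaf (leaf-admissible π admissible-root) (leaf-allSeparating π)
    in  subbasis , subbasis-isPSubbasis
      , C , D , π , belongsTo-subbasis , D⊆X , contracted⊆∁X⇒belowTop X⊆E belongsTo-subbasis C⊆∁X

  uniqueness : (F F′ : Subset n) → IsPSubbasis F → InInterval t F X → IsPSubbasis F′ → InInterval t F′ X → F ≡ F′
  uniqueness F F′ _ (C₁ , D₁ , π₁ , F∈₁ , D₁⊆X , top₁) _ (C₂ , D₂ , π₂ , F′∈₂ , D₂⊆X , top₂)
    with agreeing-leafPath-unique π₁ π₂ (belowTop⇒contracted⊆∁X F∈₁ top₁ , D₁⊆X)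
                                        (belowTop⇒contracted⊆∁X F′∈₂ top₂ , D₂⊆X)
  ... | refl , refl = belongsTo-unique F∈₁ F′∈₂
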